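{- Let $k\ge 1$ and $r\ge 1$ be integers, let $G_1,\dots,G_k$ be connected graphs, and let $n_1,\dots,n_r$ be positive integers. Let $\gamma=R(G_1,\dots,G_k)$ and $\kappa=R(K_{n_1},\dots,K_{n_r})$. If $R(G_1,\dots,G_k,K_\kappa)=(\gamma-1)(\kappa-1)+1$, then \[ R(G_1,\dots,G_k,K_{n_1},\dots,K_{n_r})=(\gamma-1)(\kappa-1)+1 . \]
   Context: For graphs $H_1,\dots,H_m$, the (multicolored) Ramsey number $R(H_1,\dots,H_m)$ is the smallest positive integer $p$ such that for every partition $(E_1,\dots,E_m)$ of the edge set of the complete graph $K_p$ (i.e. every edge coloring of $K_p$ with colors $1,\dots,m$), there is some $i$ for which the subgraph formed by the edges of $E_i$ contains a subgraph isomorphic to $H_i$. $K_t$ denotes the complete graph on $t$ vertices. -}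

module Defs where

open import Level using (0ℓ)
open import Data.Nat using (ℕ; zero; suc; _+_; _*_; _∸_; _≤_; _<_)
open import Data.Fin using (Fin)
open import Data.Product using (Σ; _×_; ∃; _,_)
open import Data.Empty using (⊥)
open import Relation.Nullary using (¬_)
open import Relation.Binary.PropositionalEquality using (_≡_; _≢_)
open import Function.Definitions using (Injective)

record Graph : Set₁ where
  field
    order  : ℕ
    Adj    : Fin order → Fin order → Set
    sym    : ∀ {u v} → Adj u v → Adj v u
    irrefl : ∀ {u} → ¬ Adj u u
open Graph public

data Walk (G : Graph) : Fin (order G) → Fin (order G) → Set where
  here : ∀ {u} → Walk G u u
  step : ∀ {u v w} → Adj G u v → Walk G v w → Walk G u w

Connected : Graph → Set
Connected G = (1 ≤ order G) × (∀ u v → Walk G u v)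

K : ℕ → Graph
K t = record
  { order = t
  ; Adj = λ u v → u ≢ v
  ; sym = λ p q → p (Relation.Binary.PropositionalEquality.sym q)
  ; irrefl = λ p → p Relation.Binary.PropositionalEquality.refl
  }

-- An edge colouring of K_p with colours Fin m (symmetric; diagonal irrelevant).
Colouring : ℕ → ℕ → Set
Colouring p m = Σ (Fin p → Fin p → Fin m) λ c → ∀ x y → c x y ≡ c y x

ContainsInColour : ∀ {p m} → Colouring p m → Fin m → Graph → Set
ContainsInColour {p} (c , _) i H =
  Σ (Fin (order H) → Fin p) λ f →
    Injective _≡_ _≡_ f × (∀ u v → Adj H u v → c (f u) (f v) ≡ i)

Arrows : ∀ {m} → (Fin m → Graph) → ℕ → Set
Arrows {m} Hs p = ∀ (c : Colouring p m) → ∃ λ i → ContainsInColour c i (Hs i)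

IsRamsey : ∀ {m} → (Fin m → Graph) → ℕ → Set
IsRamsey Hs p = (1 ≤ p) × Arrows Hs p × (∀ q → 1 ≤ q → q < p → ¬ Arrows Hs q)

-- Upper bound: merge the colours of the cliques K_{n_j} into one extra colour. By
-- hypothesis a colouring then shows some G_i in its own colour, or a K_κ in the merged
-- colour; inside that K_κ the original colours form an r-colouring of K_κ, which by
-- definition of κ contains some K_{n_j} in colour j.
-- Lower bound: from colourings of K_{γ-1} avoiding every G_i and of K_{κ-1} avoiding
-- every K_{n_j}, colour K_{(γ-1)(κ-1)} as κ-1 blocks of size γ-1, edges inside a block
-- by the first colouring and edges between blocks by the second applied to the blocks.
-- A connected monochromatic G_i cannot leave its block, and a K_{n_j} in a clique
-- colour has its vertices in pairwise different blocks.
module Submission where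

open import Defs
open import Data.Nat using (ℕ; suc; _+_; _*_; _∸_; _≤_)
open import Data.Fin using (Fin)
open import Data.Vec.Functional using (_++_; _∷_; [])

open import Data.Nat using (zero; _<_; >-nonZero; >-nonZero⁻¹)
open import Data.Nat.Properties using (+-comm; n<1+n; m<1+n⇒m≤n; m*n≢0⇒m≢0; m*n≢0⇒n≢0; ≤-trans)
open import Data.Fin using (zero; fromℕ<; _↑ˡ_; _↑ʳ_; splitAt; inject≤; quotient; remainder; combine; finToFun; funToFin)
open import Data.Fin.Properties using (↑ˡ-injective; ↑ʳ-injective; splitAt-↑ˡ; splitAt-↑ʳ; splitAt⁻¹-↑ˡ; splitAt⁻¹-↑ʳ; inject≤-injective; combine-remQuot; finToFun-funToFin; any?; all?; _≟_)
open import Data.Vec.Functional.Properties using (lookup-++ˡ; lookup-++ʳ)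
open import Data.Product using (_×_; ∃; _,_; proj₁; proj₂)
open import Data.Sum using (_⊎_; inj₁; inj₂; [_,_]′)
open import Data.Empty using (⊥-elim)
open import Function using (_∘_; id; const)
open import Function.Definitions using (Injective)
open import Relation.Nullary using (¬_; Dec; yes; no; contradiction)
open import Relation.Nullary.Decidable using (_×-dec_; _→-dec_; ¬?; map′)
open import Relation.Binary.PropositionalEquality using (_≡_; _≢_; _≗_; refl; trans; cong; cong₂; subst) renaming (sym to ≡-sym)

data SplitView (m n : ℕ) : Fin (m + n) → Set where
  inˡ : (i : Fin m) → SplitView m n (i ↑ˡ n)
  inʳ : (j : Fin n) → SplitView m n (m ↑ʳ j)

splitView : ∀ m {n} (i : Fin (m + n)) → SplitView m n i
splitView m i with splitAt m i in eq
... | inj₁ i′ = subst (SplitView m _) (splitAt⁻¹-↑ˡ eq) (inˡ i′)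
... | inj₂ j  = subst (SplitView m _) (splitAt⁻¹-↑ʳ eq) (inʳ j)

↑ˡ≢↑ʳ : ∀ {m n} (i : Fin m) (j : Fin n) → i ↑ˡ n ≢ m ↑ʳ j
↑ˡ≢↑ʳ {m} {n} i j eq with trans (≡-sym (splitAt-↑ˡ m i n)) (trans (cong (splitAt m) eq) (splitAt-↑ʳ m n j))
... | ()

remQuot-injective : ∀ m n {v w : Fin (m * n)} →
  quotient {m} n v ≡ quotient n w → remainder {m} n v ≡ remainder {m} n w → v ≡ w
remQuot-injective m n {v} {w} eq₁ eq₂ =
  trans (≡-sym (combine-remQuot {m} n v)) (trans (cong₂ combine eq₁ eq₂) (combine-remQuot {m} n w))

positive-factors : ∀ m n → 1 ≤ m * n → 1 ≤ m × 1 ≤ n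
positive-factors m n 1≤mn =
  >-nonZero⁻¹ m {{m*n≢0⇒m≢0 m {{>-nonZero 1≤mn}}}} ,
  >-nonZero⁻¹ n {{m*n≢0⇒n≢0 m {{>-nonZero 1≤mn}}}}

restrict : ∀ {p q m} → (Fin q → Fin p) → Colouring p m → Colouring q m
restrict g (c , c-sym) = (λ x y → c (g x) (g y)) , (λ x y → c-sym (g x) (g y))

recolour : ∀ {p m m′} → (Fin m → Fin m′) → Colouring p m → Colouring p m′
recolour h (c , c-sym) = (λ x y → h (c x y)) , (λ x y → cong h (c-sym x y))

ContainsInColour-restrict : ∀ {p q m} {g : Fin q → Fin p} → Injective _≡_ _≡_ g →
  ∀ (c : Colouring p m) i H → ContainsInColour (restrict g c) i H → ContainsInColour c i H
ContainsInColour-restrict {g = g} g-inj _ _ _ (f , f-inj , edges) = g ∘ f , f-inj ∘ g-inj , edges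

ContainsInColour-recolour : ∀ {p m m′} {h : Fin m → Fin m′} {i i′} → (∀ z → h z ≡ i′ → z ≡ i) →
  ∀ (c : Colouring p m) H → ContainsInColour (recolour h c) i′ H → ContainsInColour c i H
ContainsInColour-recolour h⁻¹ _ _ (f , f-inj , edges) = f , f-inj , λ u v uv → h⁻¹ _ (edges u v uv)

Arrows-mono : ∀ {m} (Hs : Fin m → Graph) {p q} → q ≤ p → Arrows Hs q → Arrows Hs p
Arrows-mono Hs q≤p arrows c with arrows (restrict (λ x → inject≤ x q≤p) c)
... | i , copy = i , ContainsInColour-restrict (inject≤-injective q≤p q≤p _ _) c i (Hs i) copy

any-function? : ∀ {m n} {P : (Fin n → Fin m) → Set} → (∀ {f g} → f ≗ g → P f → P g) →
  (∀ f → Dec (P f)) → Dec (∃ P)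
any-function? resp P? = map′ (λ (x , p) → finToFun x , p)
                             (λ (f , p) → funToFin f , resp (≡-sym ∘ finToFun-funToFin f) p)
                             (any? (P? ∘ finToFun))

ContainsInColour-K? : ∀ {p m} (c : Colouring p m) i n → Dec (ContainsInColour c i (K n))
ContainsInColour-K? (c , _) i n = any-function? resp embeds?
  where
  resp : ∀ {f g} → f ≗ g → _ → _
  resp f≗g (f-inj , edges) =
    (λ eq → f-inj (trans (f≗g _) (trans eq (≡-sym (f≗g _))))) ,
    (λ u v u≢v → trans (cong₂ c (≡-sym (f≗g u)) (≡-sym (f≗g v))) (edges u v u≢v))
  embeds? : ∀ f → Dec (Injective _≡_ _≡_ f × (∀ u v → u ≢ v → c (f u) (f v) ≡ i))
  embeds? f = map′ (λ inj → inj _ _) (λ inj _ _ → inj)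
                   (all? λ x → all? λ y → f x ≟ f y →-dec x ≟ y)
              ×-dec all? (λ u → all? λ v → ¬? (u ≟ v) →-dec c (f u) (f v) ≟ i)

module Merge (k : ℕ) {r : ℕ} (j₀ : Fin r) where

  merge : Fin (k + r) → Fin (k + 1)
  merge z = [ _↑ˡ 1 , const (k ↑ʳ zero) ]′ (splitAt k z)

  -- j₀ is a junk value: unmerge is only applied to colours that merge to k ↑ʳ zero.
  unmerge : Fin (k + r) → Fin r
  unmerge z = [ const j₀ , id ]′ (splitAt k z)

  merge-↑ˡ : ∀ z i → merge z ≡ i ↑ˡ 1 → z ≡ i ↑ˡ r
  merge-↑ˡ z i eq with splitAt k z in split
  ... | inj₁ x = trans (≡-sym (splitAt⁻¹-↑ˡ split)) (cong (_↑ˡ r) (↑ˡ-injective 1 x i eq))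
  ... | inj₂ _ = ⊥-elim (↑ˡ≢↑ʳ i zero (≡-sym eq))

  merge-↑ʳ : ∀ z → merge z ≡ k ↑ʳ zero → z ≡ k ↑ʳ unmerge z
  merge-↑ʳ z eq with splitAt k z in split
  ... | inj₁ x = ⊥-elim (↑ˡ≢↑ʳ x zero eq)
  ... | inj₂ _ = ≡-sym (splitAt⁻¹-↑ʳ split)

  ContainsInColour-unmerge : ∀ {p κ} (c : Colouring p (k + r)) {f : Fin κ → Fin p} →
    Injective _≡_ _≡_ f → (∀ u v → u ≢ v → merge (proj₁ c (f u) (f v)) ≡ k ↑ʳ zero) →
    ∀ j H → ContainsInColour (recolour unmerge (restrict f c)) j H → ContainsInColour c (k ↑ʳ j) H
  ContainsInColour-unmerge c {f} f-inj merged j H (g , g-inj , edges) =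
    f ∘ g , g-inj ∘ f-inj , λ u v uv →
      trans (merge-↑ʳ _ (merged (g u) (g v) (λ eq → irrefl H (subst (Adj H u) (≡-sym (g-inj eq)) uv))))
            (cong (k ↑ʳ_) (edges u v uv))

arrows-substitute-clique : ∀ {k r κ p} (Gs : Fin k → Graph) (Hs : Fin r → Graph) → Fin r →
  Arrows Hs κ → Arrows (Gs ++ (K κ ∷ [])) p → Arrows (Gs ++ Hs) p
arrows-substitute-clique {k} {r} {κ} Gs Hs j₀ arrowsHs arrows c =
  let i , copy = arrows (recolour merge c) in lift i (splitView k i) copy
  where
  open Merge k j₀
  lift : ∀ i → SplitView k 1 i → ContainsInColour (recolour merge c) i ((Gs ++ (K κ ∷ [])) i) →
    ∃ λ i → ContainsInColour c i ((Gs ++ Hs) i)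
  lift _ (inˡ i) copy =
    i ↑ˡ r , subst (ContainsInColour c (i ↑ˡ r)) (≡-sym (lookup-++ˡ Gs Hs i))
               (ContainsInColour-recolour (λ z → merge-↑ˡ z i) c (Gs i)
                 (subst (ContainsInColour (recolour merge c) (i ↑ˡ 1)) (lookup-++ˡ Gs (K κ ∷ []) i) copy))
  lift _ (inʳ zero) copy
    with subst (ContainsInColour (recolour merge c) (k ↑ʳ zero)) (lookup-++ʳ Gs (K κ ∷ []) zero) copy
  ... | f , f-inj , merged with arrowsHs (recolour unmerge (restrict f c))
  ...   | j , copyH = k ↑ʳ j , subst (ContainsInColour c (k ↑ʳ j)) (≡-sym (lookup-++ʳ Gs Hs j))
                                 (ContainsInColour-unmerge c f-inj merged j (Hs j) copyH)

module BlowUp {k r a b : ℕ} (c₁ : Colouring a k) (c₂ : Colouring b r) where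

  -- Vertex v of K_{a b} is vertex (position v) of the copy of K_a numbered (block v).
  position : Fin (a * b) → Fin a
  position = quotient b

  block : Fin (a * b) → Fin b
  block = remainder {a} b

  colour : Fin a → Fin a → Fin b → Fin b → Fin (k + r)
  colour x y s t with s ≟ t
  ... | yes _ = proj₁ c₁ x y ↑ˡ r
  ... | no _  = k ↑ʳ proj₁ c₂ s t

  colour-sym : ∀ x y s t → colour x y s t ≡ colour y x t s
  colour-sym x y s t with s ≟ t | t ≟ s
  ... | yes _   | yes _   = cong (_↑ˡ r) (proj₂ c₁ x y)
  ... | no _    | no _    = cong (k ↑ʳ_) (proj₂ c₂ s t)
  ... | yes s≡t | no t≢s  = contradiction (≡-sym s≡t) t≢s
  ... | no s≢t  | yes t≡s = contradiction (≡-sym t≡s) s≢t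

  blowUp : Colouring (a * b) (k + r)
  blowUp = (λ v w → colour (position v) (position w) (block v) (block w)) ,
           (λ v w → colour-sym (position v) (position w) (block v) (block w))

  blowUp-↑ˡ : ∀ v w {i} → proj₁ blowUp v w ≡ i ↑ˡ r →
    block v ≡ block w × proj₁ c₁ (position v) (position w) ≡ i
  blowUp-↑ˡ v w {i} eq with block v ≟ block w
  ... | yes same = same , ↑ˡ-injective r _ _ eq
  ... | no _     = ⊥-elim (↑ˡ≢↑ʳ i _ (≡-sym eq))

  blowUp-↑ʳ : ∀ v w {j} → proj₁ blowUp v w ≡ k ↑ʳ j →
    block v ≢ block w × proj₁ c₂ (block v) (block w) ≡ j
  blowUp-↑ʳ v w {j} eq with block v ≟ block w
  ... | yes _     = ⊥-elim (↑ˡ≢↑ʳ _ j eq)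
  ... | no differ = differ , ↑ʳ-injective k _ _ eq

  ContainsInColour-block : ∀ {i} H → (∀ u v → Walk H u v) →
    ContainsInColour blowUp (i ↑ˡ r) H → ContainsInColour c₁ i H
  ContainsInColour-block H walk (f , f-inj , edges) =
    position ∘ f , (λ eq → f-inj (remQuot-injective a b eq (same-block (walk _ _)))) ,
    λ u v uv → proj₂ (blowUp-↑ˡ (f u) (f v) (edges u v uv))
    where
    same-block : ∀ {u v} → Walk H u v → block (f u) ≡ block (f v)
    same-block here            = refl
    same-block (step {u} {v} uv rest) =
      trans (proj₁ (blowUp-↑ˡ (f u) (f v) (edges u v uv))) (same-block rest)

  ContainsInColour-across : ∀ {j} n → ContainsInColour blowUp (k ↑ʳ j) (K n) → ContainsInColour c₂ j (K n)
  ContainsInColour-across n (f , f-inj , edges) =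
    block ∘ f , block-inj , λ u v u≢v → proj₂ (blowUp-↑ʳ (f u) (f v) (edges u v u≢v))
    where
    block-inj : Injective _≡_ _≡_ (block ∘ f)
    block-inj {u} {v} eq with u ≟ v
    ... | yes u≡v = u≡v
    ... | no u≢v  = contradiction eq (proj₁ (blowUp-↑ʳ (f u) (f v) (edges u v u≢v)))

blowUp-arrows : ∀ {k r a b} (Gs : Fin k → Graph) (ns : Fin r → ℕ) → (∀ i → Connected (Gs i)) →
  Arrows (Gs ++ (K ∘ ns)) (a * b) → (c₁ : Colouring a k) (c₂ : Colouring b r) →
  (∃ λ i → ContainsInColour c₁ i (Gs i)) ⊎ (∃ λ j → ContainsInColour c₂ j (K (ns j)))
blowUp-arrows {k} {r} Gs ns connected arrows c₁ c₂ =
  let i , copy = arrows blowUp in classify i (splitView k i) copy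
  where
  open BlowUp c₁ c₂
  classify : ∀ i → SplitView k r i → ContainsInColour blowUp i ((Gs ++ (K ∘ ns)) i) →
    (∃ λ i → ContainsInColour c₁ i (Gs i)) ⊎ (∃ λ j → ContainsInColour c₂ j (K (ns j)))
  classify _ (inˡ i) copy =
    inj₁ (i , ContainsInColour-block (Gs i) (proj₂ (connected i))
                (subst (ContainsInColour blowUp (i ↑ˡ r)) (lookup-++ˡ Gs (K ∘ ns) i) copy))
  classify _ (inʳ j) copy =
    inj₂ (j , ContainsInColour-across (ns j)
                (subst (ContainsInColour blowUp (k ↑ʳ j)) (lookup-++ʳ Gs (K ∘ ns) j) copy))

-- Without excluded middle, ¬ Arrows Gs a does not provide a colouring avoiding every G_i;
-- instead, decidability of clique containment settles each c₂ directly.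
blowUp-arrows-cliques : ∀ {k r a b} (Gs : Fin k → Graph) (ns : Fin r → ℕ) → (∀ i → Connected (Gs i)) →
  Arrows (Gs ++ (K ∘ ns)) (a * b) → ¬ Arrows Gs a → Arrows (K ∘ ns) b
blowUp-arrows-cliques Gs ns connected arrows ¬arrowsGs c₂
  with any? (λ j → ContainsInColour-K? c₂ j (ns j))
... | yes clique = clique
... | no ¬clique = contradiction (λ c₁ → [ id , ⊥-elim ∘ ¬clique ]′ (blowUp-arrows Gs ns connected arrows c₁ c₂))
                                 ¬arrowsGs

theorem2 : (k r : ℕ) → 1 ≤ k → 1 ≤ r →
    (Gs : Fin k → Graph) → (∀ i → Connected (Gs i)) →
    (ns : Fin r → ℕ) → (∀ i → 1 ≤ ns i) →
    (γ κ : ℕ) → IsRamsey Gs γ → IsRamsey (λ i → K (ns i)) κ →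
    IsRamsey (Gs ++ (K κ ∷ [])) ((γ ∸ 1) * (κ ∸ 1) + 1) →
    IsRamsey (Gs ++ (λ i → K (ns i))) ((γ ∸ 1) * (κ ∸ 1) + 1)
theorem2 _ _ _ _ _ _ _ _ zero _ (() , _) _ _
theorem2 _ _ _ _ _ _ _ _ (suc _) zero _ (() , _) _
theorem2 _ _ _ 1≤r Gs connected ns _ (suc a) (suc b)
         (_ , _ , minimalGs) (_ , arrowsK , minimalK) (1≤N , arrowsN , _) =
  1≤N , arrows-substitute-clique Gs (K ∘ ns) (fromℕ< 1≤r) arrowsK arrowsN , below
  where
  below : ∀ q → 1 ≤ q → q < a * b + 1 → ¬ Arrows (Gs ++ (K ∘ ns)) q
  below q 1≤q q<N arrowsQ =
    let q≤ab = m<1+n⇒m≤n (subst (q <_) (+-comm (a * b) 1) q<N)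
        1≤a , 1≤b = positive-factors a b (≤-trans 1≤q q≤ab)
        arrowsAB = Arrows-mono (Gs ++ (K ∘ ns)) q≤ab arrowsQ
    in minimalK b 1≤b (n<1+n b)
         (blowUp-arrows-cliques Gs ns connected arrowsAB (minimalGs a 1≤a (n<1+n a)))
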